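{- Let $\mathcal{A}$ be a finite set of integers strictly greater than $1$, let $k \ge 1$ be an integer, let $b \in \mathcal{A}$, let $I \subseteq \mathcal{A} \setminus \{b\}$ and $J = I \cup \{b\}$. Then \[ C_b\,(\beta_I C_{\mathrm{lcm}(I)} + \beta_J C_{\mathrm{lcm}(J)})^k = C_b\,(\alpha_I C_{\mathrm{lcm}(I)} + \alpha_J C_{\mathrm{lcm}(J)})^k. \]
   Context: An FDDS is a pair $(S,f)$ with $S$ finite and $f:S\to S$, up to isomorphism; sum is disjoint union, product is the direct product $(S,f)\times(T,g)=(S\times T,(s,t)\mapsto(f(s),g(t)))$, and for a nonnegative integer $n$, $nC$ is the sum of $n$ copies of $C$. $C_q$ denotes the FDDS consisting of a single cycle of length $q$. For a finite set $J$ of positive integers, $\mathrm{lcm}(\emptyset)=1$, and $\delta_J$ is defined recursively by $\delta_\emptyset = 1$ and $\delta_{J\cup\{a\}} = \gcd(a,\mathrm{lcm}(J))\,\delta_J$ for $a \notin J$. For $I \subseteq \mathcal{A}$, set $\alpha_I = \delta_{\mathcal{A}} \prod_{a\in\mathcal{A}} a$ and $\beta_I = \alpha_I + (-1)^{|I|}\,\delta_I \prod_{a \in \mathcal{A}\setminus I} a$ (these are positive integers). -}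

module Defs where

open import Data.Nat using (ℕ; zero; suc; _+_; _*_)
open import Data.Nat.GCD using (gcd)
open import Data.Nat.LCM using (lcm)
open import Data.Nat.DivMod using (_mod_)
open import Data.Nat.Properties using (_≟_)
open import Data.Fin using (Fin; toℕ; _↑ˡ_; _↑ʳ_; splitAt; combine; remQuot)
open import Data.Sum using ([_,_])
open import Data.Product using (_,_; Σ)
open import Data.List using (List; []; _∷_; foldr; filter; length)
open import Data.Nat.ListAction using (product)
open import Data.List.Membership.DecPropositional _≟_ using (_∈?_)
open import Relation.Nullary.Decidable using (¬?)
open import Data.Integer as ℤ using (ℤ; +_; ∣_∣)
open import Function.Bundles using (_↔_; Inverse)
open import Relation.Binary.PropositionalEquality using (_≡_)

record FDDS : Set where
  constructor mkFDDS
  field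
    size : ℕ
    fun  : Fin size → Fin size
open FDDS public

_≅_ : FDDS → FDDS → Set
S ≅ T = Σ (Fin (size S) ↔ Fin (size T)) λ φ →
          ∀ x → Inverse.to φ (fun S x) ≡ fun T (Inverse.to φ x)

infix 4 _≅_
infixl 6 _⊕_
infixl 7 _⊗_
infixl 7 _·_
infixr 8 _^_

_⊕_ : FDDS → FDDS → FDDS
mkFDDS n f ⊕ mkFDDS m g =
  mkFDDS (n + m) (λ x → [ (λ i → f i ↑ˡ m) , (λ j → n ↑ʳ g j) ] (splitAt n x))

_⊗_ : FDDS → FDDS → FDDS
mkFDDS n f ⊗ mkFDDS m g =
  mkFDDS (n * m) (λ x → let (i , j) = remQuot m x in combine (f i) (g j))

𝟘 : FDDS
𝟘 = mkFDDS 0 (λ x → x)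

𝟙 : FDDS
𝟙 = mkFDDS 1 (λ x → x)

_·_ : ℕ → FDDS → FDDS
zero  · C = 𝟘
suc n · C = C ⊕ n · C

_^_ : FDDS → ℕ → FDDS
C ^ zero  = 𝟙
C ^ suc k = C ⊗ C ^ k

-- C q : a single cycle of length q (only used for q ≥ 1).
Cyc : ℕ → FDDS
Cyc zero    = 𝟘
Cyc (suc p) = mkFDDS (suc p) (λ i → suc (toℕ i) mod suc p)

-- Arithmetic on finite sets of positive integers, represented as
-- duplicate-free lists.

lcmL : List ℕ → ℕ
lcmL = foldr lcm 1

δ : List ℕ → ℕ
δ []      = 1
δ (a ∷ J) = gcd a (lcmL J) * δ J

_∖_ : List ℕ → List ℕ → List ℕ
A ∖ I = filter (λ a → ¬? (a ∈? I)) A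

-- α_I = δ_A ∏_{a∈A} a   (independent of I)
α : List ℕ → ℕ
α A = δ A * product A

sgn : ℕ → ℤ
sgn zero          = + 1
sgn (suc zero)    = ℤ.- (+ 1)
sgn (suc (suc n)) = sgn n

βℤ : List ℕ → List ℕ → ℤ
βℤ A I = + α A ℤ.+ sgn (length I) ℤ.* + (δ I * product (A ∖ I))

-- β_I as a natural number (β_I is a positive integer).
β : List ℕ → List ℕ → ℕ
β A I = ∣ βℤ A I ∣

-- Writing L = lcm I, L′ = lcm J = lcm(b, L) and g = gcd(b, L), the key fact is
-- C_m C_n = gcd(m, n) C_lcm(m,n).  Hence C_L′ absorbs both summands of
-- X = x C_L + y C_L′ (C_L′ C_L = L C_L′, C_L′ C_L′ = L′ C_L′), and for k ≥ 1
--   C_b X^k = (x g + y b) (x L + y L′)^(k-1) C_L′ .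
-- So it suffices that (x, y) = (β_I, β_J) and (x, y) = (α, α) give the same
-- numbers x g + y b and x L + y L′.  With D_I = δ_I ∏_{A∖I} a we have
-- β_I = α ± D_I and β_J = α ∓ D_J, so this amounts to D_I u = D_J v for
-- (u, v) = (g, b) and (L, L′); and indeed D_I = b δ_I ∏_{A∖J} a,
-- D_J = g δ_I ∏_{A∖J} a, while b L = g L′.

module Submission where

open import Defs
open import Data.Nat using (ℕ; _≤_; _<_)
open import Data.List using (List; _∷_)
open import Data.List.Relation.Unary.All using (All)
open import Data.List.Relation.Unary.Unique.Propositional using (Unique)
open import Data.List.Membership.Propositional using (_∈_; _∉_)

open import Data.Nat
  using (zero; suc; _+_; _*_; _∸_; NonZero; ≢-nonZero; ≢-nonZero⁻¹; >-nonZero; z<s)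
  renaming (_^_ to _^ⁿ_)
open import Data.Nat.Properties
open import Data.Nat.DivMod
  using (_%_; _/_; _mod_; m≡m%n+[m/n]*n; m%n<n; %-distribˡ-+; %-remove-+ʳ; m∣n⇒o%n%m≡o%m;
         m<n⇒m%n≡m; m%n%n≡m%n)
open import Data.Nat.Divisibility using (_∣_; divides; ∣-refl; ∣-antisym; ∣⇒≤)
open import Data.Nat.GCD using (gcd; gcd[m,n]∣m; gcd[m,n]∣n; gcd-greatest; gcd[m,n]≢0)
open import Data.Nat.LCM using (lcm; lcm-least; m∣lcm[m,n]; n∣lcm[m,n]; gcd*lcm)
open import Data.Nat.ListAction using (product)
open import Algebra.Properties.CommutativeSemigroup *-commutativeSemigroup using (x∙yz≈y∙xz)
open import Data.Nat.Tactic.RingSolver using (solve-∀)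
open import Data.Fin as Fin using (Fin; toℕ; splitAt; punchOut; _↑ˡ_; _↑ʳ_)
open import Data.Fin.Properties
  using (splitAt-↑ˡ; splitAt-↑ʳ; remQuot-combine; +↔⊎; *↔×; toℕ-fromℕ<; fromℕ<-cong;
         toℕ-injective; toℕ<n; any?; punchOut-injective; injective⇒≤)
  renaming (_≟_ to _≟ᶠ_)
open import Data.Integer as ℤ using (∣_∣) renaming (+_ to +ℤ_)
import Data.Integer.Properties as ℤₚ
open import Data.List using ([]; length)
open import Data.List.Properties using (filter-accept; filter-reject; filter-all)
open import Data.List.Relation.Unary.All as All using ([]; _∷_)
open import Data.List.Relation.Unary.All.Properties using (All¬⇒¬Any; ¬Any⇒All¬)
open import Data.List.Relation.Unary.Any using (here; there)
open import Data.List.Relation.Unary.AllPairs using (_∷_)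
open import Data.List.Membership.DecPropositional _≟_ using (_∈?_)
open import Data.Product using (_×_; _,_; proj₁; proj₂)
open import Data.Product.Algebra using (×-comm; ×-assoc; ×-distribˡ-⊎) renaming (×-cong to ×-↔)
open import Data.Sum using (_⊎_; inj₁; inj₂; [_,_])
open import Data.Sum.Algebra using () renaming (⊎-cong to ⊎-↔)
import Data.Sum as Sum
import Data.Product as Product
open import Function using (id; _∘_)
open import Function.Bundles using (_↔_; Inverse; Injection; mk⤖; mk↔ₛ′)
open import Function.Definitions using (Injective; StrictlySurjective)
open import Function.Consequences.Propositional using (strictlySurjective⇒surjective)
open import Function.Properties.Bijection using (⤖⇒↔)
open import Function.Properties.Inverse using (↔-refl; ↔-sym; ↔-trans; ↔⇒↣)
open import Level using (0ℓ)
open import Relation.Nullary using (Dec; yes; no; ¬?; contradiction)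
open import Relation.Binary.PropositionalEquality hiding ([_])

-- Conjugacy of systems on arbitrary types lets sums and products be ⊎ and ×,
-- keeping Fin index arithmetic out of the algebra.
record System : Set₁ where
  constructor system
  field
    State : Set
    step  : State → State
open System

⟦_⟧ : FDDS → System
⟦ S ⟧ = system (Fin (size S)) (fun S)

-- Fixed n ×ₛ S is the sum of n copies of S.
Fixed : ℕ → System
Fixed n = system (Fin n) id

infixr 6 _⊎ₛ_
infixr 7 _×ₛ_

_⊎ₛ_ : System → System → System
S ⊎ₛ T = system (State S ⊎ State T) (Sum.map (step S) (step T))

_×ₛ_ : System → System → System
S ×ₛ T = system (State S × State T) (Product.map (step S) (step T))

infix 4 _≃_
record _≃_ (S T : System) : Set where
  constructor conjugacy
  field
    iso      : State S ↔ State T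
    commutes : ∀ x → Inverse.to iso (step S x) ≡ step T (Inverse.to iso x)

≃⇒≅ : ∀ {S T} → ⟦ S ⟧ ≃ ⟦ T ⟧ → S ≅ T
≃⇒≅ (conjugacy φ commutes) = φ , commutes

≃-refl : ∀ {S} → S ≃ S
≃-refl = conjugacy ↔-refl (λ _ → refl)

≡⇒≃ : ∀ {S T} → S ≡ T → S ≃ T
≡⇒≃ refl = ≃-refl

≃-sym : ∀ {S T} → S ≃ T → T ≃ S
≃-sym {S} {T} (conjugacy φ φ-commutes) = conjugacy (↔-sym φ) commutes
  where
  open Inverse φ
  commutes : ∀ y → from (step T y) ≡ step S (from y)
  commutes y = begin
    from (step T y)              ≡⟨ cong (from ∘ step T) (strictlyInverseˡ y) ⟨
    from (step T (to (from y)))  ≡⟨ cong from (φ-commutes (from y)) ⟨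
    from (to (step S (from y)))  ≡⟨ strictlyInverseʳ _ ⟩
    step S (from y)              ∎
    where open ≡-Reasoning

infixr 2 _⨾_
_⨾_ : ∀ {S T U} → S ≃ T → T ≃ U → S ≃ U
conjugacy φ φ-commutes ⨾ conjugacy ψ ψ-commutes =
  conjugacy (↔-trans φ ψ) (λ x → trans (cong (Inverse.to ψ) (φ-commutes x)) (ψ-commutes _))

⊎ₛ-cong : ∀ {S S′ T T′} → S ≃ S′ → T ≃ T′ → S ⊎ₛ T ≃ S′ ⊎ₛ T′
⊎ₛ-cong (conjugacy φ φ-commutes) (conjugacy ψ ψ-commutes) = conjugacy (⊎-↔ φ ψ) λ
  { (inj₁ x) → cong inj₁ (φ-commutes x)
  ; (inj₂ y) → cong inj₂ (ψ-commutes y)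
  }

×ₛ-cong : ∀ {S S′ T T′} → S ≃ S′ → T ≃ T′ → S ×ₛ T ≃ S′ ×ₛ T′
×ₛ-cong (conjugacy φ φ-commutes) (conjugacy ψ ψ-commutes) =
  conjugacy (×-↔ φ ψ) (λ (x , y) → cong₂ _,_ (φ-commutes x) (ψ-commutes y))

×ₛ-comm : ∀ {S T} → S ×ₛ T ≃ T ×ₛ S
×ₛ-comm = conjugacy (×-comm _ _) (λ _ → refl)

×ₛ-assoc : ∀ {S T U} → (S ×ₛ T) ×ₛ U ≃ S ×ₛ (T ×ₛ U)
×ₛ-assoc = conjugacy (×-assoc 0ℓ _ _ _) (λ _ → refl)

×ₛ-swapˡ : ∀ {S T U} → S ×ₛ (T ×ₛ U) ≃ T ×ₛ (S ×ₛ U)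
×ₛ-swapˡ = ≃-sym ×ₛ-assoc ⨾ ×ₛ-cong ×ₛ-comm ≃-refl ⨾ ×ₛ-assoc

×ₛ-distribˡ-⊎ₛ : ∀ {S T U} → S ×ₛ (T ⊎ₛ U) ≃ S ×ₛ T ⊎ₛ S ×ₛ U
×ₛ-distribˡ-⊎ₛ = conjugacy (×-distribˡ-⊎ 0ℓ _ _ _) λ
  { (_ , inj₁ _) → refl
  ; (_ , inj₂ _) → refl
  }

×ₛ-distribʳ-⊎ₛ : ∀ {S T U} → (T ⊎ₛ U) ×ₛ S ≃ T ×ₛ S ⊎ₛ U ×ₛ S
×ₛ-distribʳ-⊎ₛ = ×ₛ-comm ⨾ ×ₛ-distribˡ-⊎ₛ ⨾ ⊎ₛ-cong ×ₛ-comm ×ₛ-comm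

Fixed-+ : ∀ m n → Fixed m ⊎ₛ Fixed n ≃ Fixed (m + n)
Fixed-+ m n = conjugacy (↔-sym +↔⊎) λ
  { (inj₁ _) → refl
  ; (inj₂ _) → refl
  }

Fixed-* : ∀ m n → Fixed m ×ₛ Fixed n ≃ Fixed (m * n)
Fixed-* m n = conjugacy (↔-sym *↔×) (λ _ → refl)

Fixed-1 : ∀ {S} → Fixed 1 ×ₛ S ≃ S
Fixed-1 = conjugacy
  (mk↔ₛ′ proj₂ (Fin.zero ,_) (λ _ → refl) λ { (Fin.zero , _) → refl ; (Fin.suc () , _) })
  (λ _ → refl)

Fixed-0 : ∀ {S} → Fixed 0 ×ₛ S ≃ Fixed 0
Fixed-0 = conjugacy (mk↔ₛ′ proj₁ (λ ()) (λ ()) λ { (() , _) }) (λ _ → refl)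

Fixed-*-assoc : ∀ m n {S} → Fixed m ×ₛ (Fixed n ×ₛ S) ≃ Fixed (m * n) ×ₛ S
Fixed-*-assoc m n = ≃-sym ×ₛ-assoc ⨾ ×ₛ-cong (Fixed-* m n) ≃-refl

Fixed-+-distrib : ∀ m n {S} → Fixed m ×ₛ S ⊎ₛ Fixed n ×ₛ S ≃ Fixed (m + n) ×ₛ S
Fixed-+-distrib m n = ≃-sym ×ₛ-distribʳ-⊎ₛ ⨾ ×ₛ-cong (Fixed-+ m n) ≃-refl

⟦⊕⟧ : ∀ S T → ⟦ S ⊕ T ⟧ ≃ ⟦ S ⟧ ⊎ₛ ⟦ T ⟧
⟦⊕⟧ (mkFDDS n f) (mkFDDS m g) = conjugacy +↔⊎ (commutes ∘ splitAt n)
  where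
  commutes : ∀ s → splitAt n ([ (λ i → f i ↑ˡ m) , (λ j → n ↑ʳ g j) ] s) ≡ Sum.map f g s
  commutes (inj₁ i) = splitAt-↑ˡ n (f i) m
  commutes (inj₂ j) = splitAt-↑ʳ n m (g j)

⟦⊗⟧ : ∀ S T → ⟦ S ⊗ T ⟧ ≃ ⟦ S ⟧ ×ₛ ⟦ T ⟧
⟦⊗⟧ (mkFDDS n f) (mkFDDS m g) = conjugacy *↔× (λ x → remQuot-combine (f _) (g _))

⟦·⟧ : ∀ n S → ⟦ n · S ⟧ ≃ Fixed n ×ₛ ⟦ S ⟧
⟦·⟧ zero    S = ≃-sym Fixed-0
⟦·⟧ (suc n) S = ⟦⊕⟧ S (n · S) ⨾ ⊎ₛ-cong (≃-sym Fixed-1) (⟦·⟧ n S) ⨾ Fixed-+-distrib 1 n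

-- Finite sets and modular arithmetic

↔-to-injective : ∀ {A B : Set} (e : A ↔ B) → Injective _≡_ _≡_ (Inverse.to e)
↔-to-injective e = Injection.injective (↔⇒↣ e)

injective⇒strictlySurjective : ∀ {n} {f : Fin n → Fin n} →
                               Injective _≡_ _≡_ f → StrictlySurjective _≡_ f
injective⇒strictlySurjective {f = f} f-injective y with any? (λ x → f x ≟ᶠ y)
... | yes hit = hit
injective⇒strictlySurjective {suc n} {f} f-injective y | no miss =
  contradiction (injective⇒≤ punched-injective) 1+n≰n
  where
  f≢y : ∀ x → y ≢ f x
  f≢y x y≡fx = miss (x , sym y≡fx)
  punched-injective : Injective _≡_ _≡_ (λ x → punchOut (f≢y x))
  punched-injective eq = f-injective (punchOut-injective (f≢y _) (f≢y _) eq)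

injective⇒↔ : ∀ {A B : Set} {n} → A ↔ Fin n → B ↔ Fin n →
              (f : A → B) → Injective _≡_ _≡_ f → A ↔ B
injective⇒↔ {n = n} eA eB f f-injective =
  ⤖⇒↔ (mk⤖ (f-injective , strictlySurjective⇒surjective f-surjective))
  where
  open Inverse
  f′ : Fin n → Fin n
  f′ = to eB ∘ f ∘ from eA
  f′-injective : Injective _≡_ _≡_ f′
  f′-injective = ↔-to-injective (↔-sym eA) ∘ f-injective ∘ ↔-to-injective eB
  f-surjective : StrictlySurjective _≡_ f
  f-surjective y =
    let (x , f′x≡y) = injective⇒strictlySurjective f′-injective (to eB y)
    in from eA x , ↔-to-injective eB f′x≡y

%≡⇒∣∸ : ∀ x y n .{{_ : NonZero n}} → x % n ≡ y % n → n ∣ y ∸ x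
%≡⇒∣∸ x y n x≡y = divides (y / n ∸ x / n) (begin
  y ∸ x                                      ≡⟨ cong₂ _∸_ (m≡m%n+[m/n]*n y n) (m≡m%n+[m/n]*n x n) ⟩
  (y % n + y / n * n) ∸ (x % n + x / n * n)  ≡⟨ cong (λ r → (r + y / n * n) ∸ (x % n + x / n * n)) x≡y ⟨
  (x % n + y / n * n) ∸ (x % n + x / n * n)  ≡⟨ [m+n]∸[m+o]≡n∸o (x % n) (y / n * n) (x / n * n) ⟩
  y / n * n ∸ x / n * n                      ≡⟨ *-distribʳ-∸ n (y / n) (x / n) ⟨
  (y / n ∸ x / n) * n                        ∎)
  where open ≡-Reasoning

-- ∸ truncates, so both differences are needed.
∣∸⇒%≡ : ∀ x y n .{{_ : NonZero n}} → n ∣ y ∸ x → n ∣ x ∸ y → x % n ≡ y % n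
∣∸⇒%≡ x y n n∣y∸x n∣x∸y with ≤-total x y
... | inj₁ x≤y = trans (sym (%-remove-+ʳ x n∣y∸x)) (cong (_% n) (m+[n∸m]≡n x≤y))
... | inj₂ y≤x = trans (cong (_% n) (sym (m+[n∸m]≡n y≤x))) (%-remove-+ʳ y n∣x∸y)

%≡-+ˡ : ∀ z x y n .{{_ : NonZero n}} → x % n ≡ y % n → (z + x) % n ≡ (z + y) % n
%≡-+ˡ z x y n x≡y = begin
  (z + x) % n            ≡⟨ %-distribˡ-+ z x n ⟩
  (z % n + x % n) % n    ≡⟨ cong (λ r → (z % n + r) % n) x≡y ⟩
  (z % n + y % n) % n    ≡⟨ %-distribˡ-+ z y n ⟨
  (z + y) % n            ∎
  where open ≡-Reasoning

%≡-cancel-+ˡ : ∀ z x y n .{{_ : NonZero n}} → (z + x) % n ≡ (z + y) % n → x % n ≡ y % n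
%≡-cancel-+ˡ z x y n z+x≡z+y = ∣∸⇒%≡ x y n
  (subst (n ∣_) ([m+n]∸[m+o]≡n∸o z y x) (%≡⇒∣∸ _ _ n z+x≡z+y))
  (subst (n ∣_) ([m+n]∸[m+o]≡n∸o z x y) (%≡⇒∣∸ _ _ n (sym z+x≡z+y)))

%≡-∣ : ∀ x y d n .{{_ : NonZero d}} .{{_ : NonZero n}} → d ∣ n → x % n ≡ y % n → x % d ≡ y % d
%≡-∣ x y d n d∣n x≡y =
  trans (sym (m∣n⇒o%n%m≡o%m d n x d∣n)) (trans (cong (_% d) x≡y) (m∣n⇒o%n%m≡o%m d n y d∣n))

%≡-lcm : ∀ x y m n .{{_ : NonZero m}} .{{_ : NonZero n}} .{{_ : NonZero (lcm m n)}} →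
         x % m ≡ y % m → x % n ≡ y % n → x % lcm m n ≡ y % lcm m n
%≡-lcm x y m n x≡y[m] x≡y[n] = ∣∸⇒%≡ x y (lcm m n)
  (lcm-least (%≡⇒∣∸ x y m x≡y[m]) (%≡⇒∣∸ x y n x≡y[n]))
  (lcm-least (%≡⇒∣∸ y x m (sym x≡y[m])) (%≡⇒∣∸ y x n (sym x≡y[n])))

%≡⇒≡ : ∀ {x y n} .{{_ : NonZero n}} → x < n → y < n → x % n ≡ y % n → x ≡ y
%≡⇒≡ x<n y<n x≡y = trans (sym (m<n⇒m%n≡m x<n)) (trans x≡y (m<n⇒m%n≡m y<n))

toℕ-mod : ∀ x n .{{_ : NonZero n}} → toℕ (x mod n) ≡ x % n
toℕ-mod x n = toℕ-fromℕ< (m%n<n x n)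

mod≡⇒%≡ : ∀ {x y n} .{{_ : NonZero n}} → x mod n ≡ y mod n → x % n ≡ y % n
mod≡⇒%≡ {x} {y} {n} eq = trans (sym (toℕ-mod x n)) (trans (cong toℕ eq) (toℕ-mod y n))

%≡⇒mod≡ : ∀ {x y n} .{{_ : NonZero n}} → x % n ≡ y % n → x mod n ≡ y mod n
%≡⇒mod≡ {x} {y} {n} eq = fromℕ<-cong (x % n) (y % n) eq (m%n<n x n) (m%n<n y n)

gcd-nonZero : ∀ m n .{{_ : NonZero m}} → NonZero (gcd m n)
gcd-nonZero m n = ≢-nonZero (gcd[m,n]≢0 m n (inj₁ (≢-nonZero⁻¹ m)))

lcm-nonZero : ∀ m n .{{_ : NonZero m}} .{{_ : NonZero n}} → NonZero (lcm m n)
lcm-nonZero m n = m*n≢0⇒n≢0 (gcd m n) {{subst NonZero (sym (gcd*lcm m n)) (m*n≢0 m n)}}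

m∣n⇒gcd[m,n]≡m : ∀ {m n} → m ∣ n → gcd m n ≡ m
m∣n⇒gcd[m,n]≡m {m} {n} m∣n = ∣-antisym (gcd[m,n]∣m m n) (gcd-greatest ∣-refl m∣n)

m∣n⇒lcm[m,n]≡n : ∀ {m n} → m ∣ n → lcm m n ≡ n
m∣n⇒lcm[m,n]≡n {m} {n} m∣n = ∣-antisym (lcm-least m∣n ∣-refl) (n∣lcm[m,n] m n)

-- Products of cycles

cycle : (l : ℕ) .{{_ : NonZero l}} → System
cycle l = system (Fin l) (λ i → suc (toℕ i) mod l)

⟦Cyc⟧ : ∀ l .{{_ : NonZero l}} → ⟦ Cyc l ⟧ ≃ cycle l
⟦Cyc⟧ (suc _) = ≃-refl

module CycleProduct (m n : ℕ) .{{_ : NonZero m}} .{{_ : NonZero n}} where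

  private
    g = gcd m n
    l = lcm m n
    instance
      g≢0 : NonZero g
      g≢0 = gcd-nonZero m n
      l≢0 : NonZero l
      l≢0 = lcm-nonZero m n

  residues-injective : ∀ {r r′ t t′} → r < g → r′ < g → t < l → t′ < l →
                     t % m ≡ t′ % m → (r + t) % n ≡ (r′ + t′) % n → r ≡ r′ × t ≡ t′
  residues-injective {r} {r′} {t} {t′} r<g r′<g t<l t′<l t≡t′[m] r+t≡r′+t′[n] = r≡r′ , t≡t′
    where
    open ≡-Reasoning
    r≡r′ : r ≡ r′
    r≡r′ = %≡⇒≡ r<g r′<g (%≡-cancel-+ˡ t r r′ g (begin
      (t + r) % g    ≡⟨ cong (_% g) (+-comm t r) ⟩
      (r + t) % g    ≡⟨ %≡-∣ (r + t) (r′ + t′) g n (gcd[m,n]∣n m n) r+t≡r′+t′[n] ⟩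
      (r′ + t′) % g  ≡⟨ %≡-+ˡ r′ t t′ g (%≡-∣ t t′ g m (gcd[m,n]∣m m n) t≡t′[m]) ⟨
      (r′ + t) % g   ≡⟨ cong (_% g) (+-comm r′ t) ⟩
      (t + r′) % g   ∎))
    t≡t′ : t ≡ t′
    t≡t′ = %≡⇒≡ t<l t′<l (%≡-lcm t t′ m n t≡t′[m]
      (%≡-cancel-+ˡ r t t′ n (subst (λ ρ → (r + t) % n ≡ (ρ + t′) % n) (sym r≡r′) r+t≡r′+t′[n])))

  -- φ (r , t) is the point reached from (0 , r) after t steps.
  φ : Fin g × Fin l → Fin m × Fin n
  φ (r , t) = toℕ t mod m , (toℕ r + toℕ t) mod n

  φ-injective : Injective _≡_ _≡_ φ
  φ-injective {r , t} {r′ , t′} φ≡ =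
    let (r≡r′ , t≡t′) = residues-injective (toℕ<n r) (toℕ<n r′) (toℕ<n t) (toℕ<n t′)
                          (mod≡⇒%≡ (cong proj₁ φ≡)) (mod≡⇒%≡ (cong proj₂ φ≡))
    in cong₂ _,_ (toℕ-injective r≡r′) (toℕ-injective t≡t′)

  φ-commutes : ∀ x → φ (step (Fixed g ×ₛ cycle l) x) ≡ step (cycle m ×ₛ cycle n) (φ x)
  φ-commutes (r , t) = cong₂ _,_ (%≡⇒mod≡ first) (%≡⇒mod≡ second)
    where
    open ≡-Reasoning
    R = toℕ r
    T = toℕ t
    first : toℕ (suc T mod l) % m ≡ suc (toℕ (T mod m)) % m
    first = begin
      toℕ (suc T mod l) % m    ≡⟨ cong (_% m) (toℕ-mod (suc T) l) ⟩
      suc T % l % m            ≡⟨ m∣n⇒o%n%m≡o%m m l (suc T) (m∣lcm[m,n] m n) ⟩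
      suc T % m                ≡⟨ %≡-+ˡ 1 _ _ m (m%n%n≡m%n T m) ⟨
      suc (T % m) % m          ≡⟨ cong (λ z → suc z % m) (toℕ-mod T m) ⟨
      suc (toℕ (T mod m)) % m  ∎
    second : (R + toℕ (suc T mod l)) % n ≡ suc (toℕ ((R + T) mod n)) % n
    second = begin
      (R + toℕ (suc T mod l)) % n    ≡⟨ cong (λ z → (R + z) % n) (toℕ-mod (suc T) l) ⟩
      (R + suc T % l) % n            ≡⟨ %≡-+ˡ R _ _ n (m∣n⇒o%n%m≡o%m n l (suc T) (n∣lcm[m,n] m n)) ⟩
      (R + suc T) % n                ≡⟨ cong (_% n) (+-suc R T) ⟩
      suc (R + T) % n                ≡⟨ %≡-+ˡ 1 _ _ n (m%n%n≡m%n (R + T) n) ⟨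
      suc ((R + T) % n) % n          ≡⟨ cong (λ z → suc z % n) (toℕ-mod (R + T) n) ⟨
      suc (toℕ ((R + T) mod n)) % n  ∎

  cycle-product : Fixed g ×ₛ cycle l ≃ cycle m ×ₛ cycle n
  cycle-product = conjugacy (injective⇒↔ (↔-sym *↔×) m×n↔g*l φ φ-injective) φ-commutes
    where
    m×n↔g*l : (Fin m × Fin n) ↔ Fin (g * l)
    m×n↔g*l = subst (λ k → (Fin m × Fin n) ↔ Fin k) (sym (gcd*lcm m n)) (↔-sym *↔×)

Cyc×Cyc : ∀ m n .{{_ : NonZero m}} .{{_ : NonZero n}} →
          ⟦ Cyc m ⟧ ×ₛ ⟦ Cyc n ⟧ ≃ Fixed (gcd m n) ×ₛ ⟦ Cyc (lcm m n) ⟧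
Cyc×Cyc m n =
  ×ₛ-cong (⟦Cyc⟧ m) (⟦Cyc⟧ n) ⨾ ≃-sym (CycleProduct.cycle-product m n)
  ⨾ ×ₛ-cong ≃-refl (≃-sym (⟦Cyc⟧ (lcm m n) {{lcm-nonZero m n}}))

Cyc×Cyc-∣ : ∀ {m n} .{{_ : NonZero m}} .{{_ : NonZero n}} → m ∣ n →
            ⟦ Cyc m ⟧ ×ₛ ⟦ Cyc n ⟧ ≃ Fixed m ×ₛ ⟦ Cyc n ⟧
Cyc×Cyc-∣ {m} {n} m∣n = Cyc×Cyc m n
  ⨾ ≡⇒≃ (cong₂ (λ d c → Fixed d ×ₛ ⟦ Cyc c ⟧) (m∣n⇒gcd[m,n]≡m m∣n) (m∣n⇒lcm[m,n]≡n {m} m∣n))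

-- Absorption

absorb-sum : ∀ {Z C} A B x y {u v} → Z ×ₛ ⟦ A ⟧ ≃ Fixed u ×ₛ C → Z ×ₛ ⟦ B ⟧ ≃ Fixed v ×ₛ C →
             Z ×ₛ ⟦ x · A ⊕ y · B ⟧ ≃ Fixed (x * u + y * v) ×ₛ C
absorb-sum A B x y {u} {v} ZA ZB =
  ×ₛ-cong ≃-refl (⟦⊕⟧ (x · A) (y · B) ⨾ ⊎ₛ-cong (⟦·⟧ x A) (⟦·⟧ y B))
  ⨾ ×ₛ-distribˡ-⊎ₛ
  ⨾ ⊎ₛ-cong (×ₛ-swapˡ ⨾ ×ₛ-cong ≃-refl ZA ⨾ Fixed-*-assoc x u)
            (×ₛ-swapˡ ⨾ ×ₛ-cong ≃-refl ZB ⨾ Fixed-*-assoc y v)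
  ⨾ Fixed-+-distrib (x * u) (y * v)

absorb-⊗ : ∀ {Z C} X Y {u v} → Z ×ₛ ⟦ X ⟧ ≃ Fixed u ×ₛ C → C ×ₛ ⟦ Y ⟧ ≃ Fixed v ×ₛ C →
           Z ×ₛ ⟦ X ⊗ Y ⟧ ≃ Fixed (u * v) ×ₛ C
absorb-⊗ X Y {u} {v} ZX CY =
  ×ₛ-cong ≃-refl (⟦⊗⟧ X Y) ⨾ ≃-sym ×ₛ-assoc ⨾ ×ₛ-cong ZX ≃-refl
  ⨾ ×ₛ-assoc ⨾ ×ₛ-cong ≃-refl CY ⨾ Fixed-*-assoc u v

absorb-^ : ∀ {C} X k {s} → C ×ₛ ⟦ X ⟧ ≃ Fixed s ×ₛ C → C ×ₛ ⟦ X ^ k ⟧ ≃ Fixed (s ^ⁿ k) ×ₛ C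
absorb-^ X zero    CX = ×ₛ-comm
absorb-^ X (suc k) CX = absorb-⊗ X (X ^ k) CX (absorb-^ X k CX)

Cyc⊗power : ∀ b L .{{_ : NonZero b}} .{{_ : NonZero L}} x y k →
            ⟦ Cyc b ⊗ (x · Cyc L ⊕ y · Cyc (lcm b L)) ^ suc k ⟧
              ≃ Fixed ((x * gcd b L + y * b) * (x * L + y * lcm b L) ^ⁿ k) ×ₛ ⟦ Cyc (lcm b L) ⟧
Cyc⊗power b L x y k =
  ⟦⊗⟧ (Cyc b) (X ^ suc k)
  ⨾ absorb-⊗ X (X ^ k)
      (absorb-sum (Cyc L) (Cyc L′) x y (Cyc×Cyc b L) (Cyc×Cyc-∣ (m∣lcm[m,n] b L)))
      (absorb-^ X k
        (absorb-sum (Cyc L) (Cyc L′) x y (×ₛ-comm ⨾ Cyc×Cyc-∣ (n∣lcm[m,n] b L)) (Cyc×Cyc-∣ ∣-refl)))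
  where
  L′ = lcm b L
  X = x · Cyc L ⊕ y · Cyc L′
  instance
    L′≢0 : NonZero L′
    L′≢0 = lcm-nonZero b L

-- The numbers α and β

∖-∷-∉ : ∀ {c} A I → c ∉ A → A ∖ (c ∷ I) ≡ A ∖ I
∖-∷-∉     []      I c∉A = refl
∖-∷-∉ {c} (a ∷ A) I c∉A = by-cases (a ∈? I)
  where
  open ≡-Reasoning
  by-cases : Dec (a ∈ I) → (a ∷ A) ∖ (c ∷ I) ≡ (a ∷ A) ∖ I
  by-cases (yes a∈I) = begin
    (a ∷ A) ∖ (c ∷ I)  ≡⟨ filter-reject (λ x → ¬? (x ∈? c ∷ I)) (λ a∉cI → a∉cI (there a∈I)) ⟩
    A ∖ (c ∷ I)        ≡⟨ ∖-∷-∉ A I (c∉A ∘ there) ⟩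
    A ∖ I              ≡⟨ filter-reject (λ x → ¬? (x ∈? I)) (λ a∉I → a∉I a∈I) ⟨
    (a ∷ A) ∖ I        ∎
  by-cases (no a∉I) = begin
    (a ∷ A) ∖ (c ∷ I)  ≡⟨ filter-accept (λ x → ¬? (x ∈? c ∷ I)) a∉cI ⟩
    a ∷ A ∖ (c ∷ I)    ≡⟨ cong (a ∷_) (∖-∷-∉ A I (c∉A ∘ there)) ⟩
    a ∷ A ∖ I          ≡⟨ filter-accept (λ x → ¬? (x ∈? I)) a∉I ⟨
    (a ∷ A) ∖ I        ∎
    where
    a∉cI : a ∉ c ∷ I
    a∉cI (here refl) = c∉A (here refl)
    a∉cI (there a∈I) = a∉I a∈I

product-∖-∷ : ∀ {c} A I → Unique A → c ∈ A → c ∉ I → product (A ∖ I) ≡ c * product (A ∖ (c ∷ I))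
product-∖-∷ (a ∷ A) I (a≢A ∷ _) (here refl) a∉I = begin
  product ((a ∷ A) ∖ I)            ≡⟨ cong product (filter-accept (λ x → ¬? (x ∈? I)) a∉I) ⟩
  a * product (A ∖ I)              ≡⟨ cong (λ B → a * product B) (∖-∷-∉ A I (All¬⇒¬Any a≢A)) ⟨
  a * product (A ∖ (a ∷ I))        ≡⟨ cong (λ B → a * product B) a-rejected ⟨
  a * product ((a ∷ A) ∖ (a ∷ I))  ∎
  where
  open ≡-Reasoning
  a-rejected : (a ∷ A) ∖ (a ∷ I) ≡ A ∖ (a ∷ I)
  a-rejected = filter-reject (λ x → ¬? (x ∈? a ∷ I)) (λ a∉aI → a∉aI (here refl))
product-∖-∷ {c} (a ∷ A) I (a≢A ∷ A-unique) (there c∈A) c∉I = by-cases (a ∈? I)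
  where
  open ≡-Reasoning
  P = product (A ∖ (c ∷ I))
  by-cases : Dec (a ∈ I) → product ((a ∷ A) ∖ I) ≡ c * product ((a ∷ A) ∖ (c ∷ I))
  by-cases (yes a∈I) = begin
    product ((a ∷ A) ∖ I)            ≡⟨ cong product (filter-reject (λ x → ¬? (x ∈? I)) (λ a∉I → a∉I a∈I)) ⟩
    product (A ∖ I)                  ≡⟨ product-∖-∷ A I A-unique c∈A c∉I ⟩
    c * P                            ≡⟨ cong (λ B → c * product B) a-rejected ⟨
    c * product ((a ∷ A) ∖ (c ∷ I))  ∎
    where
    a-rejected : (a ∷ A) ∖ (c ∷ I) ≡ A ∖ (c ∷ I)
    a-rejected = filter-reject (λ x → ¬? (x ∈? c ∷ I)) (λ a∉cI → a∉cI (there a∈I))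
  by-cases (no a∉I) = begin
    product ((a ∷ A) ∖ I)            ≡⟨ cong product (filter-accept (λ x → ¬? (x ∈? I)) a∉I) ⟩
    a * product (A ∖ I)              ≡⟨ cong (a *_) (product-∖-∷ A I A-unique c∈A c∉I) ⟩
    a * (c * P)                      ≡⟨ x∙yz≈y∙xz a c P ⟩
    c * (a * P)                      ≡⟨ cong (λ B → c * product B) a-accepted ⟨
    c * product ((a ∷ A) ∖ (c ∷ I))  ∎
    where
    a∉cI : a ∉ c ∷ I
    a∉cI (here refl) = All¬⇒¬Any a≢A c∈A
    a∉cI (there a∈I) = a∉I a∈I
    a-accepted : (a ∷ A) ∖ (c ∷ I) ≡ a ∷ A ∖ (c ∷ I)
    a-accepted = filter-accept (λ x → ¬? (x ∈? c ∷ I)) a∉cI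

δ-nonZero : ∀ {A} → All NonZero A → NonZero (δ A)
δ-nonZero []                  = _
δ-nonZero {a ∷ A} (a≢0 ∷ A≢0) =
  m*n≢0 (gcd a (lcmL A)) (δ A) {{gcd-nonZero a (lcmL A) {{a≢0}}}} {{δ-nonZero A≢0}}

lcmL-nonZero : ∀ {I} → All NonZero I → NonZero (lcmL I)
lcmL-nonZero []                  = _
lcmL-nonZero {a ∷ I} (a≢0 ∷ I≢0) = lcm-nonZero a (lcmL I) {{a≢0}} {{lcmL-nonZero I≢0}}

-- β A I is, by definition, ∣ α A ± deviation A I ∣.
deviation : List ℕ → List ℕ → ℕ
deviation A I = δ I * product (A ∖ I)

deviation≤product : ∀ A I → Unique A → All NonZero A → Unique I → All (_∈ A) I →
                    deviation A I ≤ product A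
deviation≤product A [] _ _ _ _ = ≤-reflexive (trans (*-identityˡ _) (cong product A∖[]≡A))
  where
  A∖[]≡A : A ∖ [] ≡ A
  A∖[]≡A = filter-all (λ x → ¬? (x ∈? [])) (All.universal (λ _ ()) A)
deviation≤product A (c ∷ I) A-unique A≢0 (c≢I ∷ I-unique) (c∈A ∷ I⊆A) = begin
  gcd c (lcmL I) * δ I * P  ≤⟨ *-monoˡ-≤ P (*-monoˡ-≤ (δ I) gcd≤c) ⟩
  c * δ I * P               ≡⟨ trans (cong (_* P) (*-comm c (δ I))) (*-assoc (δ I) c P) ⟩
  δ I * (c * P)             ≡⟨ cong (δ I *_) (product-∖-∷ A I A-unique c∈A (All¬⇒¬Any c≢I)) ⟨
  deviation A I             ≤⟨ deviation≤product A I A-unique A≢0 I-unique I⊆A ⟩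
  product A                 ∎
  where
  open ≤-Reasoning
  P = product (A ∖ (c ∷ I))
  gcd≤c : gcd c (lcmL I) ≤ c
  gcd≤c = ∣⇒≤ {{All.lookup A≢0 c∈A}} (gcd[m,n]∣m c (lcmL I))

deviation≤α : ∀ A I → Unique A → All NonZero A → Unique I → All (_∈ A) I → deviation A I ≤ α A
deviation≤α A I A-unique A≢0 I-unique I⊆A =
  ≤-trans (deviation≤product A I A-unique A≢0 I-unique I⊆A) (m≤n*m (product A) (δ A) {{δ-nonZero A≢0}})

deviation-∷ : ∀ {b u v} A I → Unique A → b ∈ A → b ∉ I → b * u ≡ gcd b (lcmL I) * v →
              deviation A I * u ≡ deviation A (b ∷ I) * v
deviation-∷ {b} {u} {v} A I A-unique b∈A b∉I bu≡gv = begin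
  δ I * product (A ∖ I) * u  ≡⟨ cong (λ p → δ I * p * u) (product-∖-∷ A I A-unique b∈A b∉I) ⟩
  δ I * (b * P) * u          ≡⟨ regroupˡ (δ I) b P u ⟩
  δ I * P * (b * u)          ≡⟨ cong (δ I * P *_) bu≡gv ⟩
  δ I * P * (g * v)          ≡⟨ regroupʳ (δ I) P g v ⟩
  g * δ I * P * v            ∎
  where
  open ≡-Reasoning
  P = product (A ∖ (b ∷ I))
  g = gcd b (lcmL I)
  regroupˡ : ∀ d b p u → d * (b * p) * u ≡ d * p * (b * u)
  regroupˡ = solve-∀
  regroupʳ : ∀ d p g v → d * p * (g * v) ≡ g * d * p * v
  regroupʳ = solve-∀

sgn-alternates : ∀ n → (sgn n ≡ +ℤ 1 × sgn (suc n) ≡ ℤ.- +ℤ 1)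
                     ⊎ (sgn n ≡ ℤ.- +ℤ 1 × sgn (suc n) ≡ +ℤ 1)
sgn-alternates zero          = inj₁ (refl , refl)
sgn-alternates (suc zero)    = inj₂ (refl , refl)
sgn-alternates (suc (suc n)) = sgn-alternates n

∣a+x∣ : ∀ a x → ∣ +ℤ a ℤ.+ +ℤ 1 ℤ.* +ℤ x ∣ ≡ a + x
∣a+x∣ a x = cong (λ z → ∣ +ℤ a ℤ.+ z ∣) (ℤₚ.*-identityˡ (+ℤ x))

∣a-x∣ : ∀ a x → x ≤ a → ∣ +ℤ a ℤ.+ ℤ.- +ℤ 1 ℤ.* +ℤ x ∣ ≡ a ∸ x
∣a-x∣ a x x≤a = cong ∣_∣ (begin
  +ℤ a ℤ.+ ℤ.- +ℤ 1 ℤ.* +ℤ x  ≡⟨ cong (λ z → +ℤ a ℤ.+ z) (ℤₚ.-1*i≡-i (+ℤ x)) ⟩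
  +ℤ a ℤ.- +ℤ x               ≡⟨ ℤₚ.m-n≡m⊖n a x ⟩
  a ℤ.⊖ x                     ≡⟨ ℤₚ.⊖-≥ x≤a ⟩
  +ℤ (a ∸ x)                  ∎)
  where open ≡-Reasoning

+-∸-balance : ∀ a x x′ u v → x′ ≤ a → x * u ≡ x′ * v → (a + x) * u + (a ∸ x′) * v ≡ a * u + a * v
+-∸-balance a x x′ u v x′≤a xu≡x′v = begin
  (a + x) * u + (a ∸ x′) * v            ≡⟨ cong₂ _+_ (*-distribʳ-+ u a x) (*-distribʳ-∸ v a x′) ⟩
  (a * u + x * u) + (a * v ∸ x′ * v)    ≡⟨ cong (λ w → (a * u + w) + (a * v ∸ x′ * v)) xu≡x′v ⟩
  (a * u + x′ * v) + (a * v ∸ x′ * v)   ≡⟨ +-assoc (a * u) (x′ * v) (a * v ∸ x′ * v) ⟩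
  a * u + (x′ * v + (a * v ∸ x′ * v))   ≡⟨ cong (a * u +_) (m+[n∸m]≡n (*-monoˡ-≤ v x′≤a)) ⟩
  a * u + a * v                         ∎
  where open ≡-Reasoning

β-balance : ∀ n a x x′ u v → x ≤ a → x′ ≤ a → x * u ≡ x′ * v →
            ∣ +ℤ a ℤ.+ sgn n ℤ.* +ℤ x ∣ * u + ∣ +ℤ a ℤ.+ sgn (suc n) ℤ.* +ℤ x′ ∣ * v ≡ a * u + a * v
β-balance n a x x′ u v x≤a x′≤a xu≡x′v with sgn-alternates n
... | inj₁ (sₙ≡1 , sₙ₊₁≡-1) rewrite sₙ≡1 | sₙ₊₁≡-1 | ∣a+x∣ a x | ∣a-x∣ a x′ x′≤a =
  +-∸-balance a x x′ u v x′≤a xu≡x′v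
... | inj₂ (sₙ≡-1 , sₙ₊₁≡1) rewrite sₙ≡-1 | sₙ₊₁≡1 | ∣a-x∣ a x x≤a | ∣a+x∣ a x′ =
  trans (+-comm ((a ∸ x) * u) _)
    (trans (+-∸-balance a x′ x v u x≤a (sym xu≡x′v)) (+-comm (a * v) (a * u)))

lemma7 : (A : List ℕ) → Unique A → All (1 <_) A →
         (k : ℕ) → 1 ≤ k →
         (b : ℕ) → b ∈ A →
         (I : List ℕ) → Unique I → All (_∈ A) I → b ∉ I →
         Cyc b ⊗ (β A I · Cyc (lcmL I) ⊕ β A (b ∷ I) · Cyc (lcmL (b ∷ I))) ^ k
           ≅ Cyc b ⊗ (α A · Cyc (lcmL I) ⊕ α A · Cyc (lcmL (b ∷ I))) ^ k
lemma7 A A-unique 1<A (suc k) _ b b∈A I I-unique I⊆A b∉I = ≃⇒≅ (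
  Cyc⊗power b L (β A I) (β A (b ∷ I)) k
  ⨾ ≡⇒≃ (cong (λ N → Fixed N ×ₛ ⟦ Cyc (lcm b L) ⟧) same-count)
  ⨾ ≃-sym (Cyc⊗power b L (α A) (α A) k))
  where
  A≢0 : All NonZero A
  A≢0 = All.map (λ 1<a → >-nonZero (<-trans z<s 1<a)) 1<A
  L = lcmL I
  instance
    b≢0 : NonZero b
    b≢0 = All.lookup A≢0 b∈A
    L≢0 : NonZero L
    L≢0 = lcmL-nonZero (All.map (All.lookup A≢0) I⊆A)
  balance : ∀ {u v} → b * u ≡ gcd b L * v → β A I * u + β A (b ∷ I) * v ≡ α A * u + α A * v
  balance bu≡gv = β-balance (length I) (α A) _ _ _ _
    (deviation≤α A I A-unique A≢0 I-unique I⊆A)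
    (deviation≤α A (b ∷ I) A-unique A≢0 (¬Any⇒All¬ I b∉I ∷ I-unique) (b∈A ∷ I⊆A))
    (deviation-∷ A I A-unique b∈A b∉I bu≡gv)
  same-count : (β A I * gcd b L + β A (b ∷ I) * b) * (β A I * L + β A (b ∷ I) * lcm b L) ^ⁿ k
             ≡ (α A * gcd b L + α A * b) * (α A * L + α A * lcm b L) ^ⁿ k
  same-count = cong₂ (λ c s → c * s ^ⁿ k) (balance (*-comm b (gcd b L))) (balance (sym (gcd*lcm b L)))
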